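{- Let $k\ge1$ and let $w_1,\dots,w_k$ be packed words with respective maximal letters $a_1,\dots,a_k$. Let $T$ be the set of packed words appearing in the expansion of $\mathbf M_{w_1}\cdots\mathbf M_{w_k}$, i.e. the set of packed words $u$ of length $|w_1|+\cdots+|w_k|$ such that, cutting $u$ into consecutive factors $u=u^{(1)}\cdots u^{(k)}$ with $|u^{(j)}|=|w_j|$, one has $\mathrm{pack}(u^{(j)})=w_j$ for all $j$. If $t_d$ denotes the number of elements of $T$ with maximal letter $d$, then $$\sum_d(-1)^d t_d=(-1)^{a_1+\cdots+a_k}.$$
   Context: A word over the positive integers is packed if its set of letters is $\{1,\dots,r\}$ for some $r\ge 0$. $\mathrm{pack}(w)$ is obtained from $w$ by replacing every occurrence of the $j$-th smallest letter of $w$ by $j$. In $\mathbf{WQSym}$, $\mathbf M_u=\sum_{\mathrm{pack}(w)=u}w$, and $\mathbf M_{u'}\mathbf M_{u''}=\sum\mathbf M_u$ over packed words $u=vw$ with $\mathrm{pack}(v)=u'$, $\mathrm{pack}(w)=u''$. -}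

module Defs where

open import Data.Nat using (ℕ; zero; suc; _⊔_; _≤_; _≤?_; _≟_)
open import Data.List using (List; []; _∷_; foldr; length; filter; take; drop; map; upTo; sum)
open import Data.List.Membership.Propositional using (_∈_)
open import Data.List.Relation.Unary.All using (All)
open import Data.List.Relation.Unary.Unique.Propositional using (Unique)
open import Data.List.Relation.Unary.Any using (Any)
import Data.List as L
open import Data.Integer as ℤ using (ℤ)
open import Data.Product using (_×_)
open import Relation.Binary.PropositionalEquality using (_≡_)
open import Function.Bundles using (_⇔_)

maxL : List ℕ → ℕ
maxL = foldr _⊔_ 0

Packed : List ℕ → Set
Packed w = All (λ x → 1 ≤ x) w × (∀ j → 1 ≤ j → j ≤ maxL w → j ∈ w)

rank : List ℕ → ℕ → ℕ
rank w x = length (L.deduplicate _≟_ (filter (_≤? x) w))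

-- pack(w): replace each occurrence of the j-th smallest letter by j
pack : List ℕ → List ℕ
pack w = map (rank w) w

Cut : List (List ℕ) → List ℕ → Set
Cut [] u = u ≡ []
Cut (w ∷ ws) u = (pack (take (length w) u) ≡ w) × Cut ws (drop (length w) u)

-- u is a packed word appearing in the expansion of M_{w_1} ⋯ M_{w_k}
InProduct : List (List ℕ) → List ℕ → Set
InProduct ws u = Packed u × Cut ws u

sgn : ℕ → ℤ
sgn zero = ℤ.+ 1
sgn (suc d) = ℤ.- sgn d

count : List (List ℕ) → ℕ → ℕ
count T d = length (filter (λ u → maxL u ≟ d) T)

-- Σ_{d=0}^{N} (-1)^d t_d, with N the largest maximal letter in T
-- (so all d with t_d ≠ 0 are included)
altSum : List (List ℕ) → ℤ
altSum T = foldr ℤ._+_ (ℤ.+ 0) (map (λ d → sgn d ℤ.* ℤ.+ count T d) (upTo (suc (foldr _⊔_ 0 (map maxL T)))))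

-- Induction on the total length of w₁ … w_k. Sort the words u ∈ T by the pattern S that records which factors
-- of u contain its maximal letter. For a pattern with at least one mark, deleting that letter everywhere is a
-- bijection from this class onto the set T for the words obtained from the wⱼ by deleting the maximal letter of
-- each marked wⱼ (the inverse reinserts a new top letter at the places of the old maxima), and it lowers the
-- maximal letter by exactly one. So by induction the class contributes minus a product of one sign per factor.
-- Summed over all patterns, including the unmarked one whose product is (-1)^{a₁+⋯+a_k}, these products factorise
-- into ∏ⱼ ((-1)^{aⱼ-1} + (-1)^{aⱼ}), which is 1 if all wⱼ are empty and 0 otherwise. The unmarked pattern itself
-- only occurs for u = [], which lies in T exactly when all wⱼ are empty, so the total is (-1)^{a₁+⋯+a_k}.
module Submission where

open import Defs
open import Data.Bool as Bool using (Bool; true; false; if_then_else_)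
open import Data.Bool.ListAction using (or; all)
open import Data.Empty using (⊥-elim)
open import Data.Integer as ℤ using (ℤ; 0ℤ; 1ℤ; -1ℤ)
import Data.Integer.Properties as ℤP
open import Data.Integer.Tactic.RingSolver using (solve-∀)
open import Data.List
  using (List; []; _∷_; null; map; foldr; length; filter; take; drop; concat; _++_; upTo; deduplicate)
open import Data.List.Properties
  using (≡-dec; ∷-injectiveˡ; ∷-injectiveʳ; filter-all; filter-none; filter-accept; filter-reject; filter-++;
         length-map; length-filter; take++drop≡id; map-cong-local)
open import Data.List.Membership.Propositional using (_∈_; _∉_)
open import Data.List.Membership.Propositional.Properties
  using (∈-filter⁺; ∈-filter⁻; ∈-deduplicate⁺; ∈-deduplicate⁻; ∈-concat⁺′; ∈-map⁺; ∈-map⁻; ∈-upTo⁺;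
         ∈-++⁺ˡ; ∈-++⁺ʳ; ∈-++⁻)
open import Data.List.Relation.Binary.Pointwise using (Pointwise; []; _∷_)
open import Data.List.Relation.Binary.Subset.Propositional using (_⊆_)
open import Data.List.Relation.Unary.All as All using (All; []; _∷_)
open import Data.List.Relation.Unary.AllPairs using ([]; _∷_)
open import Data.List.Relation.Unary.Any using (here; there)
open import Data.List.Relation.Unary.Unique.Propositional using (Unique)
import Data.List.Relation.Unary.Unique.Propositional.Properties as UP
open import Data.List.Relation.Unary.Unique.DecPropositional.Properties using (deduplicate-!)
open import Data.Nat using (ℕ; zero; suc; _+_; _⊔_; _≤_; _<_; _≤?_; _≟_; z≤n; s≤s)
open import Data.Nat.Induction using (<-wellFounded)
open import Data.Nat.Properties
open import Data.List.Membership.DecPropositional _≟_ using (_∈?_)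
open import Data.Product using (_×_; _,_; proj₁; proj₂)
open import Data.Sum using (inj₁; inj₂)
open import Function using (_∘_; _on_)
open import Function.Bundles using (_⇔_; Equivalence; mk⇔)
open import Induction.WellFounded using (Acc; acc)
open import Relation.Binary.Core using (_Preserves_⟶_)
import Relation.Binary.Construct.On as On
open import Relation.Binary.PropositionalEquality
  using (_≡_; _≢_; refl; sym; trans; cong; cong₂; subst; module ≡-Reasoning)
open import Relation.Nullary using (Dec; yes; no; ¬_; ¬?; does)
open import Relation.Nullary.Decidable using (dec-true; dec-false)

module _ {A : Set} where

  remove : ∀ {x : A} {ys} → x ∈ ys → List A
  remove {ys = _ ∷ ys} (here _) = ys
  remove {ys = y ∷ _} (there p) = y ∷ remove p

  length-remove : ∀ {x : A} {ys} (p : x ∈ ys) → length ys ≡ suc (length (remove p))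
  length-remove (here _) = refl
  length-remove (there p) = cong suc (length-remove p)

  ∈-remove : ∀ {x z : A} {ys} (p : x ∈ ys) → z ∈ ys → z ≢ x → z ∈ remove p
  ∈-remove (here refl) (here e) z≢x = ⊥-elim (z≢x e)
  ∈-remove (here refl) (there q) _ = q
  ∈-remove (there p) (here e) _ = here e
  ∈-remove (there p) (there q) z≢x = there (∈-remove p q z≢x)

  Unique⇒length-≤ : ∀ {xs ys : List A} → Unique xs → xs ⊆ ys → length xs ≤ length ys
  Unique⇒length-≤ {[]} _ _ = z≤n
  Unique⇒length-≤ {x ∷ xs} {ys} (x∉xs ∷ xs!) xs⊆ys =
    subst (suc (length xs) ≤_) (sym (length-remove x∈ys)) (s≤s (Unique⇒length-≤ xs! xs⊆ys-x))
    where
    x∈ys : x ∈ ys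
    x∈ys = xs⊆ys (here refl)
    xs⊆ys-x : xs ⊆ remove x∈ys
    xs⊆ys-x z∈xs = ∈-remove x∈ys (xs⊆ys (there z∈xs)) (λ z≡x → All.lookup x∉xs z∈xs (sym z≡x))

distinct : List ℕ → List ℕ
distinct = deduplicate _≟_

#distinct : List ℕ → ℕ
#distinct xs = length (distinct xs)

distinct⁺ : ∀ {xs} → xs ⊆ distinct xs
distinct⁺ = ∈-deduplicate⁺ _≟_

distinct⁻ : ∀ xs → distinct xs ⊆ xs
distinct⁻ xs = ∈-deduplicate⁻ _≟_ xs

#distinct-mono : ∀ {xs ys} → xs ⊆ ys → #distinct xs ≤ #distinct ys
#distinct-mono {xs} xs⊆ys =
  Unique⇒length-≤ (deduplicate-! _≟_ xs) (λ z∈ → distinct⁺ (xs⊆ys (distinct⁻ xs z∈)))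

#distinct-< : ∀ {xs ys y} → xs ⊆ ys → y ∈ ys → y ∉ xs → #distinct xs < #distinct ys
#distinct-< {xs} {ys} {y} xs⊆ys y∈ys y∉xs = Unique⇒length-≤ {xs = y ∷ distinct xs} {distinct ys}
  (All.tabulate (λ z∈ y≡z → y∉xs (subst (_∈ xs) (sym y≡z) (distinct⁻ xs z∈))) ∷ deduplicate-! _≟_ xs)
  λ { (here refl) → distinct⁺ y∈ys ; (there z∈) → distinct⁺ (xs⊆ys (distinct⁻ xs z∈)) }

#distinct-∷ : ∀ {d xs ys} → d ∉ xs → d ∈ ys → xs ⊆ ys → ys ⊆ d ∷ xs →
              #distinct ys ≡ suc (#distinct xs)
#distinct-∷ {d} {xs} {ys} d∉xs d∈ys xs⊆ys ys⊆d∷xs = ≤-antisym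
  (Unique⇒length-≤ (deduplicate-! _≟_ ys) λ z∈ → split (ys⊆d∷xs (distinct⁻ ys z∈)))
  (#distinct-< xs⊆ys d∈ys d∉xs)
  where
  split : ∀ {z} → z ∈ d ∷ xs → z ∈ d ∷ distinct xs
  split (here e) = here e
  split (there p) = there (distinct⁺ p)

≤-maxL : ∀ {x} xs → x ∈ xs → x ≤ maxL xs
≤-maxL (y ∷ xs) (here refl) = m≤m⊔n y (maxL xs)
≤-maxL (y ∷ xs) (there p) = ≤-trans (≤-maxL xs p) (m≤n⊔m y (maxL xs))

maxL-lub : ∀ {b} xs → All (_≤ b) xs → maxL xs ≤ b
maxL-lub [] [] = z≤n
maxL-lub (x ∷ xs) (p ∷ ps) = ⊔-lub p (maxL-lub xs ps)

maxL-∈ : ∀ x xs → maxL (x ∷ xs) ∈ x ∷ xs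
maxL-∈ x [] = here (⊔-identityʳ x)
maxL-∈ x (y ∷ xs) with ⊔-sel x (maxL (y ∷ xs))
... | inj₁ e = here e
... | inj₂ e = there (subst (_∈ y ∷ xs) (sym e) (maxL-∈ y xs))

maxL-≡ : ∀ {d} xs → d ∈ xs → All (_≤ d) xs → maxL xs ≡ d
maxL-≡ xs d∈xs xs≤d = ≤-antisym (maxL-lub xs xs≤d) (≤-maxL xs d∈xs)

maxL-map-mono : ∀ {f} → f Preserves _≤_ ⟶ _≤_ → ∀ x xs → maxL (map f (x ∷ xs)) ≡ f (maxL (x ∷ xs))
maxL-map-mono {f} f-mono x [] = trans (⊔-identityʳ (f x)) (cong f (sym (⊔-identityʳ x)))
maxL-map-mono {f} f-mono x (y ∷ xs) =
  trans (cong (f x ⊔_) (maxL-map-mono f-mono y xs)) (sym (mono-≤-distrib-⊔ f-mono x (maxL (y ∷ xs))))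

filter-≤-mono : ∀ w {x y} → x ≤ y → filter (_≤? x) w ⊆ filter (_≤? y) w
filter-≤-mono w {x} {y} x≤y z∈ =
  let (z∈w , z≤x) = ∈-filter⁻ (_≤? x) {xs = w} z∈ in ∈-filter⁺ (_≤? y) z∈w (≤-trans z≤x x≤y)

rank-mono : ∀ w → rank w Preserves _≤_ ⟶ _≤_
rank-mono w x≤y = #distinct-mono (filter-≤-mono w x≤y)

rank-< : ∀ w {x y} → y ∈ w → x < y → rank w x < rank w y
rank-< w {x} {y} y∈w x<y = #distinct-<
  (filter-≤-mono w (<⇒≤ x<y))
  (∈-filter⁺ (_≤? y) y∈w ≤-refl)
  (λ y∈ → <⇒≱ x<y (proj₂ (∈-filter⁻ (_≤? x) {xs = w} y∈)))

rank-maxL : ∀ w → rank w (maxL w) ≡ #distinct w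
rank-maxL w = cong #distinct (filter-all (_≤? maxL w) (All.tabulate (≤-maxL w)))

maxL-pack : ∀ x → maxL (pack x) ≡ #distinct x
maxL-pack [] = refl
maxL-pack (a ∷ as) = trans (maxL-map-mono (rank-mono (a ∷ as)) a as) (rank-maxL (a ∷ as))

delete : ℕ → List ℕ → List ℕ
delete m = filter (λ y → ¬? (y ≟ m))

deleteMax : List ℕ → List ℕ
deleteMax u = delete (maxL u) u

delete-here : ∀ {m y} w → y ≡ m → delete m (y ∷ w) ≡ delete m w
delete-here {m} w y≡m = filter-reject (λ y → ¬? (y ≟ m)) (λ y≢m → y≢m y≡m)

delete-there : ∀ {m y} w → y ≢ m → delete m (y ∷ w) ≡ y ∷ delete m w
delete-there {m} w y≢m = filter-accept (λ y → ¬? (y ≟ m)) y≢m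

∈-delete⁻ : ∀ {m z} w → z ∈ delete m w → z ∈ w × z ≢ m
∈-delete⁻ {m} w = ∈-filter⁻ (λ y → ¬? (y ≟ m)) {xs = w}

∈-delete⁺ : ∀ {m z w} → z ∈ w → z ≢ m → z ∈ delete m w
∈-delete⁺ {m} = ∈-filter⁺ (λ y → ¬? (y ≟ m))

delete-∉ : ∀ {m w} → m ∉ w → delete m w ≡ w
delete-∉ {m} m∉w =
  filter-all (λ y → ¬? (y ≟ m)) (All.tabulate λ z∈w z≡m → m∉w (subst (_∈ _) z≡m z∈w))

delete-concat : ∀ m xss → delete m (concat xss) ≡ concat (map (delete m) xss)
delete-concat m [] = refl
delete-concat m (xs ∷ xss) =
  trans (filter-++ (λ y → ¬? (y ≟ m)) xs (concat xss)) (cong (delete m xs ++_) (delete-concat m xss))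

length-delete-< : ∀ {m} w → m ∈ w → length (delete m w) < length w
length-delete-< {m} (m ∷ w) (here refl) rewrite delete-here w (refl {x = m}) =
  s≤s (length-filter (λ y → ¬? (y ≟ m)) w)
length-delete-< {m} (y ∷ w) (there m∈w) with y ≟ m
... | yes refl rewrite delete-here w (refl {x = m}) =
  s≤s (length-filter (λ y → ¬? (y ≟ m)) w)
... | no y≢m rewrite delete-there w y≢m = s≤s (length-delete-< w m∈w)

filter-≤-delete : ∀ {y d} → y < d → ∀ w → filter (_≤? y) (delete d w) ≡ filter (_≤? y) w
filter-≤-delete y<d [] = refl
filter-≤-delete {y} {d} y<d (z ∷ w) with z ≟ d
... | yes refl rewrite delete-here w (refl {x = z}) | filter-reject (_≤? y) {xs = w} (<⇒≱ y<d) =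
  filter-≤-delete y<d w
... | no z≢d rewrite delete-there w z≢d with z ≤? y
...   | yes z≤y rewrite filter-accept (_≤? y) {xs = delete d w} z≤y | filter-accept (_≤? y) {xs = w} z≤y =
  cong (z ∷_) (filter-≤-delete y<d w)
...   | no z≰y rewrite filter-reject (_≤? y) {xs = delete d w} z≰y | filter-reject (_≤? y) {xs = w} z≰y =
  filter-≤-delete y<d w

rank-delete : ∀ {y d} → y < d → ∀ w → rank (delete d w) y ≡ rank w y
rank-delete y<d w = cong #distinct (filter-≤-delete y<d w)

Packed-[] : Packed []
Packed-[] = [] , λ j 1≤j j≤0 → ⊥-elim (<⇒≱ 1≤j j≤0)

-- The letters of a packed word are exactly 1, …, maxL, so the next letter below the top is maxL - 1.
maxL-deleteMax : ∀ c w → Packed (c ∷ w) → suc (maxL (deleteMax (c ∷ w))) ≡ maxL (c ∷ w)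
maxL-deleteMax c w (w≥1 , w-covers) with maxL (c ∷ w) in eq
... | zero = ⊥-elim (<⇒≱ (All.lookup w≥1 (here refl)) (subst (c ≤_) eq (≤-maxL (c ∷ w) (here refl))))
... | suc zero = cong (suc ∘ maxL) (filter-none (λ y → ¬? (y ≟ 1)) (All.tabulate λ {z} z∈ z≢1 →
        z≢1 (≤-antisym (subst (z ≤_) eq (≤-maxL (c ∷ w) z∈)) (All.lookup w≥1 z∈))))
... | suc (suc k) = cong suc (maxL-≡ (delete (suc (suc k)) (c ∷ w))
        (∈-delete⁺ (w-covers (suc k) (s≤s z≤n) (n≤1+n (suc k))) (λ e → 1+n≢n (sym e)))
        (All.tabulate λ {z} z∈ → let (z∈w , z≢m) = ∈-delete⁻ (c ∷ w) z∈ in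
           ≤-pred (≤∧≢⇒< (subst (z ≤_) eq (≤-maxL (c ∷ w) z∈w)) z≢m)))

Packed-deleteMax : ∀ w → Packed w → Packed (deleteMax w)
Packed-deleteMax [] _ = Packed-[]
Packed-deleteMax (c ∷ w) (w≥1 , w-covers) =
  All.tabulate (λ z∈ → All.lookup w≥1 (proj₁ (∈-delete⁻ (c ∷ w) z∈))) ,
  λ j 1≤j j≤ → let j<m = subst (j <_) (maxL-deleteMax c w (w≥1 , w-covers)) (s≤s j≤) in
    ∈-delete⁺ (w-covers j 1≤j (<⇒≤ j<m)) (<⇒≢ j<m)

refill : ℕ → ℕ → List ℕ → List ℕ → List ℕ
refill d m [] x = []
refill d m (c ∷ w) x with c ≟ m
... | yes _ = d ∷ refill d m w x
... | no _ with x
...   | [] = refill d m w []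
...   | y ∷ x' = y ∷ refill d m w x'

map-refill : ∀ (f : ℕ → ℕ) d m w x → map f (refill d m w x) ≡ refill (f d) m w (map f x)
map-refill f d m [] x = refl
map-refill f d m (c ∷ w) x with c ≟ m
... | yes _ = cong (f d ∷_) (map-refill f d m w x)
... | no _ with x
...   | [] = map-refill f d m w []
...   | y ∷ x' = cong (f y ∷_) (map-refill f d m w x')

refill-delete : ∀ m w → refill m m w (delete m w) ≡ w
refill-delete m [] = refl
refill-delete m (c ∷ w) with c ≟ m
... | yes refl rewrite delete-here w (refl {x = c}) = cong (c ∷_) (refill-delete c w)
... | no c≢m rewrite delete-there w c≢m = cong (c ∷_) (refill-delete m w)

delete-refill : ∀ d m w x → length x ≡ length (delete m w) → All (_≢ d) x → delete d (refill d m w x) ≡ x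
delete-refill d m [] [] _ _ = refl
delete-refill d m (c ∷ w) x len x≢d with c ≟ m
... | yes refl rewrite delete-here (refill d c w x) (refl {x = d}) | delete-here w (refl {x = c}) =
  delete-refill d c w x len x≢d
... | no c≢m rewrite delete-there w c≢m with x | len | x≢d
...   | y ∷ x' | len' | y≢d ∷ x'≢d rewrite delete-there (refill d m w x') y≢d =
  cong (y ∷_) (delete-refill d m w x' (suc-injective len') x'≢d)

∈-refill : ∀ d m w x → m ∈ w → d ∈ refill d m w x
∈-refill d m (c ∷ w) x m∈ with c ≟ m
... | yes _ = here refl
... | no c≢m with x | m∈
...   | _ | here m≡c = ⊥-elim (c≢m (sym m≡c))
...   | [] | there m∈w = ∈-refill d m w [] m∈w
...   | y ∷ x' | there m∈w = there (∈-refill d m w x' m∈w)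

refill-⊆ : ∀ d m w x → refill d m w x ⊆ d ∷ x
refill-⊆ d m (c ∷ w) x z∈ with c ≟ m
... | yes _ = case z∈
  where case : ∀ {z} → z ∈ d ∷ refill d m w x → z ∈ d ∷ x
        case (here e) = here e
        case (there p) = refill-⊆ d m w x p
... | no _ with x
...   | [] = refill-⊆ d m w [] z∈
...   | y ∷ x' = case z∈
  where case : ∀ {z} → z ∈ y ∷ refill d m w x' → z ∈ d ∷ y ∷ x'
        case (here e) = there (here e)
        case (there p) with refill-⊆ d m w x' p
        ... | here e = here e
        ... | there q = there (there q)

refill-map-delete : ∀ (g : ℕ → ℕ) d m x → All (λ y → g y ≡ m ⇔ y ≡ d) x →
                    refill d m (map g x) (delete d x) ≡ x
refill-map-delete g d m [] [] = refl
refill-map-delete g d m (y ∷ x) (y↦m ∷ x↦m) with g y ≟ m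
... | yes gy≡m rewrite Equivalence.to y↦m gy≡m | delete-here x (refl {x = d}) =
  cong (d ∷_) (refill-map-delete g d m x x↦m)
... | no gy≢m rewrite delete-there x (gy≢m ∘ Equivalence.from y↦m) =
  cong (y ∷_) (refill-map-delete g d m x x↦m)

delete-map : ∀ (g : ℕ → ℕ) d m x → All (λ y → g y ≡ m ⇔ y ≡ d) x →
             delete m (map g x) ≡ map g (delete d x)
delete-map g d m [] [] = refl
delete-map g d m (y ∷ x) (y↦m ∷ x↦m) with g y ≟ m
... | yes gy≡m rewrite delete-here (map g x) gy≡m | delete-here x (Equivalence.to y↦m gy≡m) =
  delete-map g d m x x↦m
... | no gy≢m rewrite delete-there (map g x) gy≢m | delete-there x (gy≢m ∘ Equivalence.from y↦m) =
  cong (g y ∷_) (delete-map g d m x x↦m)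

rank-≡-rank-max⇔ : ∀ {d} x → d ∈ x → All (_≤ d) x → All (λ y → rank x y ≡ rank x d ⇔ y ≡ d) x
rank-≡-rank-max⇔ {d} x d∈x x≤d = All.tabulate λ {y} y∈x →
  mk⇔ (λ ranks≡ → case (y ≟ d) (All.lookup x≤d y∈x) ranks≡) (λ { refl → refl })
  where
  case : ∀ {y} → Dec (y ≡ d) → y ≤ d → rank x y ≡ rank x d → y ≡ d
  case (yes y≡d) _ _ = y≡d
  case (no y≢d) y≤d ranks≡ = ⊥-elim (<⇒≢ (rank-< x d∈x (≤∧≢⇒< y≤d y≢d)) ranks≡)

maxL-pack-rank : ∀ {d} x → d ∈ x → All (_≤ d) x → maxL (pack x) ≡ rank x d
maxL-pack-rank {d} x d∈x x≤d = begin
  maxL (pack x)    ≡⟨ maxL-pack x ⟩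
  #distinct x      ≡⟨ rank-maxL x ⟨
  rank x (maxL x)  ≡⟨ cong (rank x) (maxL-≡ x d∈x x≤d) ⟩
  rank x d         ∎
  where open ≡-Reasoning

pack-delete-max : ∀ {d} x → d ∈ x → All (_≤ d) x → pack (delete d x) ≡ deleteMax (pack x)
pack-delete-max {d} x d∈x x≤d = begin
  map (rank (delete d x)) (delete d x)  ≡⟨ map-cong-local (All.tabulate same-rank) ⟩
  map (rank x) (delete d x)             ≡⟨ delete-map (rank x) d (rank x d) x (rank-≡-rank-max⇔ x d∈x x≤d) ⟨
  delete (rank x d) (pack x)            ≡⟨ cong (λ m → delete m (pack x)) (maxL-pack-rank x d∈x x≤d) ⟨
  deleteMax (pack x)                    ∎
  where
  open ≡-Reasoning
  same-rank : ∀ {y} → y ∈ delete d x → rank (delete d x) y ≡ rank x y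
  same-rank y∈ = let (y∈x , y≢d) = ∈-delete⁻ x y∈ in rank-delete (≤∧≢⇒< (All.lookup x≤d y∈x) y≢d) x

refill-pack-delete : ∀ {d} x → d ∈ x → All (_≤ d) x → refill d (maxL (pack x)) (pack x) (delete d x) ≡ x
refill-pack-delete {d} x d∈x x≤d rewrite maxL-pack-rank x d∈x x≤d =
  refill-map-delete (rank x) d (rank x d) x (rank-≡-rank-max⇔ x d∈x x≤d)

module _ {d} (x' : List ℕ) (c : ℕ) (w : List ℕ) (cw-packed : Packed (c ∷ w))
         (x'-packs : pack x' ≡ deleteMax (c ∷ w)) (x'<d : All (_< d) x') where

  private
    m : ℕ
    m = maxL (c ∷ w)
    X : List ℕ
    X = refill d m (c ∷ w) x'

  delete-refill-top : delete d X ≡ x'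
  delete-refill-top = delete-refill d m (c ∷ w) x'
    (trans (sym (length-map (rank x') x')) (cong length x'-packs)) (All.map <⇒≢ x'<d)

  private
    d∈X : d ∈ X
    d∈X = ∈-refill d m (c ∷ w) x' (maxL-∈ c w)

    X⊆d∷x' : X ⊆ d ∷ x'
    X⊆d∷x' = refill-⊆ d m (c ∷ w) x'

    x'⊆X : x' ⊆ X
    x'⊆X {z} z∈ = proj₁ (∈-delete⁻ X (subst (z ∈_) (sym delete-refill-top) z∈))

    maxL-X : maxL X ≡ d
    maxL-X = maxL-≡ X d∈X (All.tabulate λ z∈ → bound (X⊆d∷x' z∈))
      where bound : ∀ {z} → z ∈ d ∷ x' → z ≤ d
            bound (here refl) = ≤-refl
            bound (there p) = <⇒≤ (All.lookup x'<d p)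

    d∉x' : d ∉ x'
    d∉x' d∈x' = <-irrefl refl (All.lookup x'<d d∈x')

    rank-X-d : rank X d ≡ m
    rank-X-d = begin
      rank X d                  ≡⟨ cong (rank X) maxL-X ⟨
      rank X (maxL X)           ≡⟨ rank-maxL X ⟩
      #distinct X               ≡⟨ #distinct-∷ d∉x' d∈X x'⊆X X⊆d∷x' ⟩
      suc (#distinct x')        ≡⟨ cong suc (maxL-pack x') ⟨
      suc (maxL (pack x'))      ≡⟨ cong (suc ∘ maxL) x'-packs ⟩
      suc (maxL (deleteMax (c ∷ w))) ≡⟨ maxL-deleteMax c w cw-packed ⟩
      m                         ∎
      where open ≡-Reasoning

  pack-refill : pack X ≡ c ∷ w
  pack-refill = begin
    map (rank X) X                                ≡⟨ map-refill (rank X) d m (c ∷ w) x' ⟩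
    refill (rank X d) m (c ∷ w) (map (rank X) x') ≡⟨ cong₂ (λ a b → refill a m (c ∷ w) b) rank-X-d
                                                       (map-cong-local (All.tabulate same-rank)) ⟩
    refill m m (c ∷ w) (pack x')                  ≡⟨ cong (refill m m (c ∷ w)) x'-packs ⟩
    refill m m (c ∷ w) (deleteMax (c ∷ w))        ≡⟨ refill-delete m (c ∷ w) ⟩
    c ∷ w                                         ∎
    where
    open ≡-Reasoning
    same-rank : ∀ {y} → y ∈ x' → rank X y ≡ rank x' y
    same-rank {y} y∈ = trans (sym (rank-delete (All.lookup x'<d y∈) X)) (cong (λ l → rank l y) delete-refill-top)

factors : List (List ℕ) → List ℕ → List (List ℕ)
factors [] u = []
factors (w ∷ ws) u = take (length w) u ∷ factors ws (drop (length w) u)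

Packs : List (List ℕ) → List (List ℕ) → Set
Packs = Pointwise (λ w x → pack x ≡ w)

take-length-++ : ∀ (x r : List ℕ) → take (length x) (x ++ r) ≡ x
take-length-++ [] r = refl
take-length-++ (a ∷ x) r = cong (a ∷_) (take-length-++ x r)

drop-length-++ : ∀ (x r : List ℕ) → drop (length x) (x ++ r) ≡ r
drop-length-++ [] r = refl
drop-length-++ (a ∷ x) r = drop-length-++ x r

length-pack : ∀ x → length (pack x) ≡ length x
length-pack x = length-map (rank x) x

length-factors : ∀ ws u → length (factors ws u) ≡ length ws
length-factors [] u = refl
length-factors (w ∷ ws) u = cong suc (length-factors ws (drop (length w) u))

Cut⇒Packs : ∀ ws u → Cut ws u → Packs ws (factors ws u)
Cut⇒Packs [] u _ = []
Cut⇒Packs (w ∷ ws) u (packs , cut) = packs ∷ Cut⇒Packs ws (drop (length w) u) cut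

Cut⇒concat-factors : ∀ ws u → Cut ws u → concat (factors ws u) ≡ u
Cut⇒concat-factors [] u refl = refl
Cut⇒concat-factors (w ∷ ws) u (_ , cut) =
  trans (cong (take (length w) u ++_) (Cut⇒concat-factors ws (drop (length w) u) cut)) (take++drop≡id (length w) u)

Packs⇒Cut : ∀ {ws us} → Packs ws us → Cut ws (concat us)
Packs⇒Cut [] = refl
Packs⇒Cut (_∷_ {y = x} {ys = us} refl packs)
  rewrite length-pack x | take-length-++ x (concat us) | drop-length-++ x (concat us) = refl , Packs⇒Cut packs

factors-concat : ∀ {ws us} → Packs ws us → factors ws (concat us) ≡ us
factors-concat [] = refl
factors-concat (_∷_ {y = x} {ys = us} refl packs)
  rewrite length-pack x | take-length-++ x (concat us) | drop-length-++ x (concat us) =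
  cong (x ∷_) (factors-concat packs)

factors-≤-maxL : ∀ ws u → Cut ws u → All (All (_≤ maxL u)) (factors ws u)
factors-≤-maxL ws u cut = All.tabulate λ x∈ → All.tabulate λ z∈ →
  ≤-maxL u (subst (_ ∈_) (Cut⇒concat-factors ws u cut) (∈-concat⁺′ z∈ x∈))

occurs : ℕ → List ℕ → Bool
occurs d x = does (d ∈? x)

hits : ℕ → List (List ℕ) → List Bool
hits d = map (occurs d)

maxPattern : List (List ℕ) → List ℕ → List Bool
maxPattern ws u = hits (maxL u) (factors ws u)

deleteMaxAt : List Bool → List (List ℕ) → List (List ℕ)
deleteMaxAt (b ∷ S) (w ∷ ws) = (if b then deleteMax w else w) ∷ deleteMaxAt S ws
deleteMaxAt _ _ = []

refillAt : ℕ → List Bool → List (List ℕ) → List (List ℕ) → List (List ℕ)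
refillAt d (b ∷ S) (w ∷ ws) (x ∷ us) = (if b then refill d (maxL w) w x else x) ∷ refillAt d S ws us
refillAt _ _ _ _ = []

admissible : List Bool → List (List ℕ) → Bool
admissible [] [] = true
admissible (true ∷ S) ([] ∷ ws) = false
admissible (true ∷ S) ((_ ∷ _) ∷ ws) = admissible S ws
admissible (false ∷ S) (_ ∷ ws) = admissible S ws
admissible _ _ = false

length-maxPattern : ∀ ws u → length (maxPattern ws u) ≡ length ws
length-maxPattern ws u = trans (length-map _ (factors ws u)) (length-factors ws u)

or-hits⁻ : ∀ d us → or (hits d us) ≡ true → d ∈ concat us
or-hits⁻ d (x ∷ us) or≡true with d ∈? x
... | yes d∈x = ∈-++⁺ˡ d∈x
... | no _ = ∈-++⁺ʳ x (or-hits⁻ d us or≡true)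

or-hits⁺ : ∀ d us → d ∈ concat us → or (hits d us) ≡ true
or-hits⁺ d (x ∷ us) d∈ with d ∈? x
... | yes _ = refl
... | no d∉x with ∈-++⁻ x d∈
...   | inj₁ d∈x = ⊥-elim (d∉x d∈x)
...   | inj₂ d∈us = or-hits⁺ d us d∈us

admissible-hits : ∀ {d ws us} → Packs ws us → admissible (hits d us) ws ≡ true
admissible-hits [] = refl
admissible-hits {d} (_∷_ {y = x} refl packs) with d ∈? x
... | yes (here _) = admissible-hits packs
... | yes (there _) = admissible-hits packs
... | no _ = admissible-hits packs

Packs-deleteMaxAt : ∀ {d ws us} → Packs ws us → All (All (_≤ d)) us →
                    Packs (deleteMaxAt (hits d us) ws) (map (delete d) us)
Packs-deleteMaxAt [] [] = []
Packs-deleteMaxAt {d} (_∷_ {y = x} refl packs) (x≤d ∷ us≤d) with d ∈? x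
... | yes d∈x = pack-delete-max x d∈x x≤d ∷ Packs-deleteMaxAt packs us≤d
... | no d∉x = cong pack (delete-∉ d∉x) ∷ Packs-deleteMaxAt packs us≤d

refillAt-delete : ∀ {d ws us} → Packs ws us → All (All (_≤ d)) us →
                  refillAt d (hits d us) ws (map (delete d) us) ≡ us
refillAt-delete [] [] = refl
refillAt-delete {d} (_∷_ {y = x} refl packs) (x≤d ∷ us≤d) with d ∈? x
... | yes d∈x = cong₂ _∷_ (refill-pack-delete x d∈x x≤d) (refillAt-delete packs us≤d)
... | no d∉x = cong₂ _∷_ (delete-∉ d∉x) (refillAt-delete packs us≤d)

Packs-refillAt : ∀ {d} S ws us' → Packs (deleteMaxAt S ws) us' → admissible S ws ≡ true → All Packed ws →
  All (All (_< d)) us' →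
  Packs ws (refillAt d S ws us') × hits d (refillAt d S ws us') ≡ S × map (delete d) (refillAt d S ws us') ≡ us'
Packs-refillAt [] [] [] [] _ _ _ = [] , refl , refl
Packs-refillAt {d} (true ∷ S) ((c ∷ w) ∷ ws) (x' ∷ us') (x'-packs ∷ packs) adm
               (cw-packed ∷ ws-packed) (x'<d ∷ us'<d) =
  let (packs' , hits≡ , deletes≡) = Packs-refillAt S ws us' packs adm ws-packed us'<d in
  pack-refill x' c w cw-packed x'-packs x'<d ∷ packs' ,
  cong₂ _∷_ (dec-true (d ∈? _) (∈-refill d (maxL (c ∷ w)) (c ∷ w) x' (maxL-∈ c w))) hits≡ ,
  cong₂ _∷_ (delete-refill-top x' c w cw-packed x'-packs x'<d) deletes≡
Packs-refillAt {d} (false ∷ S) (w ∷ ws) (x' ∷ us') (x'-packs ∷ packs) adm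
               (_ ∷ ws-packed) (x'<d ∷ us'<d) =
  let (packs' , hits≡ , deletes≡) = Packs-refillAt S ws us' packs adm ws-packed us'<d in
  x'-packs ∷ packs' ,
  cong₂ _∷_ (dec-false (d ∈? x') d∉x') hits≡ , cong₂ _∷_ (delete-∉ d∉x') deletes≡
  where
  d∉x' : d ∉ x'
  d∉x' d∈x' = <-irrefl refl (All.lookup x'<d d∈x')

deleteMax-lowers : ∀ u → Packed u → maxL u ∈ u → suc (maxL (deleteMax u)) ≡ maxL u
deleteMax-lowers (c ∷ u) u-packed _ = maxL-deleteMax c u u-packed

module _ {u v : List ℕ} (top∈u : suc (maxL v) ∈ u) (u-delete : delete (suc (maxL v)) u ≡ v) where

  private
    d : ℕ
    d = suc (maxL v)

    ∈-below : ∀ {z} → z ∈ u → z ≢ d → z ∈ v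
    ∈-below z∈u z≢d = subst (_ ∈_) u-delete (∈-delete⁺ z∈u z≢d)

  maxL-adjoin-top : maxL u ≡ d
  maxL-adjoin-top = maxL-≡ u top∈u (All.tabulate λ {z} z∈u → case (z ≟ d) z∈u)
    where case : ∀ {z} → Dec (z ≡ d) → z ∈ u → z ≤ d
          case (yes refl) _ = ≤-refl
          case (no z≢d) z∈u = ≤-trans (≤-maxL v (∈-below z∈u z≢d)) (n≤1+n _)

  Packed-adjoin-top : Packed v → Packed u
  Packed-adjoin-top (v≥1 , v-covers) = u≥1 , u-covers
    where
    u≥1 : All (1 ≤_) u
    u≥1 = All.tabulate λ {z} z∈u → case (z ≟ d) z∈u
      where case : ∀ {z} → Dec (z ≡ d) → z ∈ u → 1 ≤ z
            case (yes refl) _ = s≤s z≤n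
            case (no z≢d) z∈u = All.lookup v≥1 (∈-below z∈u z≢d)
    u-covers : ∀ j → 1 ≤ j → j ≤ maxL u → j ∈ u
    u-covers j 1≤j j≤ with j ≟ d
    ... | yes refl = top∈u
    ... | no j≢d = proj₁ (∈-delete⁻ u (subst (j ∈_) (sym u-delete)
                     (v-covers j 1≤j (≤-pred (≤∧≢⇒< (subst (j ≤_) maxL-adjoin-top j≤) j≢d)))))

deleteMax-factors : ∀ ws u → Cut ws u → deleteMax u ≡ concat (map (delete (maxL u)) (factors ws u))
deleteMax-factors ws u cut =
  trans (cong (delete (maxL u)) (sym (Cut⇒concat-factors ws u cut))) (delete-concat (maxL u) (factors ws u))

InProduct-deleteMax : ∀ ws u → InProduct ws u → InProduct (deleteMaxAt (maxPattern ws u) ws) (deleteMax u)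
InProduct-deleteMax ws u (u-packed , cut) =
  Packed-deleteMax u u-packed ,
  subst (Cut (deleteMaxAt (maxPattern ws u) ws)) (sym (deleteMax-factors ws u cut))
    (Packs⇒Cut (Packs-deleteMaxAt (Cut⇒Packs ws u cut) (factors-≤-maxL ws u cut)))

maxPattern-nonempty : ∀ ws c u → Cut ws (c ∷ u) → or (maxPattern ws (c ∷ u)) ≡ true
maxPattern-nonempty ws c u cut =
  or-hits⁺ (maxL (c ∷ u)) (factors ws (c ∷ u))
    (subst (_ ∈_) (sym (Cut⇒concat-factors ws (c ∷ u) cut)) (maxL-∈ c u))

maxL-∈-maxPattern : ∀ ws u → Cut ws u → or (maxPattern ws u) ≡ true → maxL u ∈ u
maxL-∈-maxPattern ws u cut or≡true =
  subst (maxL u ∈_) (Cut⇒concat-factors ws u cut) (or-hits⁻ (maxL u) (factors ws u) or≡true)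

insertTop : List Bool → List (List ℕ) → List ℕ → List ℕ
insertTop S ws v = concat (refillAt (suc (maxL v)) S ws (factors (deleteMaxAt S ws) v))

insertTop-deleteMax : ∀ ws u → InProduct ws u → or (maxPattern ws u) ≡ true →
                      insertTop (maxPattern ws u) ws (deleteMax u) ≡ u
insertTop-deleteMax ws u (u-packed , cut) or≡true = begin
  concat (refillAt (suc (maxL (deleteMax u))) S ws (factors (deleteMaxAt S ws) (deleteMax u)))
    ≡⟨ cong₂ (λ a b → concat (refillAt a S ws b))
             (deleteMax-lowers u u-packed (maxL-∈-maxPattern ws u cut or≡true))
             (trans (cong (factors (deleteMaxAt S ws)) (deleteMax-factors ws u cut))
                    (factors-concat (Packs-deleteMaxAt packs us≤d))) ⟩
  concat (refillAt d S ws (map (delete d) us)) ≡⟨ cong concat (refillAt-delete packs us≤d) ⟩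
  concat us                                    ≡⟨ Cut⇒concat-factors ws u cut ⟩
  u                                            ∎
  where
  open ≡-Reasoning
  d : ℕ
  d = maxL u
  S : List Bool
  S = maxPattern ws u
  us : List (List ℕ)
  us = factors ws u
  packs : Packs ws us
  packs = Cut⇒Packs ws u cut
  us≤d : All (All (_≤ d)) us
  us≤d = factors-≤-maxL ws u cut

InProduct-insertTop : ∀ S ws v → InProduct (deleteMaxAt S ws) v → admissible S ws ≡ true → or S ≡ true →
  All Packed ws →
  InProduct ws (insertTop S ws v) × maxPattern ws (insertTop S ws v) ≡ S × deleteMax (insertTop S ws v) ≡ v
InProduct-insertTop S ws v (v-packed , cut) adm or≡true ws-packed =
  (Packed-adjoin-top top∈u u-delete v-packed , Packs⇒Cut packs) ,
  trans (cong₂ (λ m l → hits m l) maxL-u (factors-concat packs)) hits≡ ,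
  trans (cong (λ m → delete m u) maxL-u) u-delete
  where
  d : ℕ
  d = suc (maxL v)
  us' : List (List ℕ)
  us' = factors (deleteMaxAt S ws) v
  us'<d : All (All (_< d)) us'
  us'<d = All.map (All.map s≤s) (factors-≤-maxL (deleteMaxAt S ws) v cut)
  us : List (List ℕ)
  us = refillAt d S ws us'
  u : List ℕ
  u = concat us
  refilled : Packs ws us × hits d us ≡ S × map (delete d) us ≡ us'
  refilled = Packs-refillAt S ws us' (Cut⇒Packs (deleteMaxAt S ws) v cut) adm ws-packed us'<d
  packs : Packs ws us
  packs = proj₁ refilled
  hits≡ : hits d us ≡ S
  hits≡ = proj₁ (proj₂ refilled)
  top∈u : d ∈ u
  top∈u = or-hits⁻ d us (subst (λ S → or S ≡ true) (sym hits≡) or≡true)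
  u-delete : delete d u ≡ v
  u-delete = begin
    delete d (concat us)         ≡⟨ delete-concat d us ⟩
    concat (map (delete d) us)   ≡⟨ cong concat (proj₂ (proj₂ refilled)) ⟩
    concat us'                   ≡⟨ Cut⇒concat-factors (deleteMaxAt S ws) v cut ⟩
    v                            ∎
    where open ≡-Reasoning
  maxL-u : maxL u ≡ d
  maxL-u = maxL-adjoin-top top∈u u-delete

Σ[_]_ : {A : Set} → List A → (A → ℤ) → ℤ
Σ[ xs ] f = foldr ℤ._+_ 0ℤ (map f xs)

module _ {A : Set} where

  Σ-cong : ∀ (xs : List A) {f g : A → ℤ} → (∀ {x} → x ∈ xs → f x ≡ g x) → Σ[ xs ] f ≡ Σ[ xs ] g
  Σ-cong [] _ = refl
  Σ-cong (x ∷ xs) f≡g = cong₂ ℤ._+_ (f≡g (here refl)) (Σ-cong xs (f≡g ∘ there))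

  Σ-const : ∀ (xs : List A) {f : A → ℤ} {c} → (∀ {x} → x ∈ xs → f x ≡ c) →
            Σ[ xs ] f ≡ c ℤ.* ℤ.+ length xs
  Σ-const [] {c = c} _ = sym (ℤP.*-zeroʳ c)
  Σ-const (x ∷ xs) {f} {c} f≡c = begin
    f x ℤ.+ Σ[ xs ] f                    ≡⟨ cong₂ ℤ._+_ (f≡c (here refl)) (Σ-const xs (f≡c ∘ there)) ⟩
    c ℤ.+ c ℤ.* ℤ.+ length xs            ≡⟨ ℤ-lemma c (ℤ.+ length xs) ⟩
    c ℤ.* ℤ.+ suc (length xs)            ∎
    where
    open ≡-Reasoning
    ℤ-lemma : ∀ (a n : ℤ) → a ℤ.+ a ℤ.* n ≡ a ℤ.* (1ℤ ℤ.+ n)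
    ℤ-lemma = solve-∀

  Σ-0 : ∀ (xs : List A) → Σ[ xs ] (λ _ → 0ℤ) ≡ 0ℤ
  Σ-0 xs = trans (Σ-const xs (λ _ → refl)) (ℤP.*-zeroˡ (ℤ.+ length xs))

  Σ-+ : ∀ (xs : List A) (f g : A → ℤ) → Σ[ xs ] (λ x → f x ℤ.+ g x) ≡ Σ[ xs ] f ℤ.+ Σ[ xs ] g
  Σ-+ [] f g = refl
  Σ-+ (x ∷ xs) f g =
    trans (cong (λ t → f x ℤ.+ g x ℤ.+ t) (Σ-+ xs f g)) (ℤ-lemma (f x) (g x) (Σ[ xs ] f) (Σ[ xs ] g))
    where ℤ-lemma : ∀ (a b c d : ℤ) → a ℤ.+ b ℤ.+ (c ℤ.+ d) ≡ a ℤ.+ c ℤ.+ (b ℤ.+ d)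
          ℤ-lemma = solve-∀

  Σ-* : ∀ (xs : List A) (c : ℤ) (f : A → ℤ) → Σ[ xs ] (λ x → c ℤ.* f x) ≡ c ℤ.* Σ[ xs ] f
  Σ-* [] c f = sym (ℤP.*-zeroʳ c)
  Σ-* (x ∷ xs) c f =
    trans (cong (λ t → c ℤ.* f x ℤ.+ t) (Σ-* xs c f)) (sym (ℤP.*-distribˡ-+ c (f x) (Σ[ xs ] f)))

  Σ-neg : ∀ (xs : List A) (f : A → ℤ) → Σ[ xs ] (λ x → ℤ.- f x) ≡ ℤ.- Σ[ xs ] f
  Σ-neg xs f = begin
    Σ[ xs ] (λ x → ℤ.- f x)     ≡⟨ Σ-cong xs (λ {x} _ → ℤP.-1*i≡-i (f x)) ⟨
    Σ[ xs ] (λ x → -1ℤ ℤ.* f x) ≡⟨ Σ-* xs -1ℤ f ⟩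
    -1ℤ ℤ.* Σ[ xs ] f           ≡⟨ ℤP.-1*i≡-i (Σ[ xs ] f) ⟩
    ℤ.- Σ[ xs ] f               ∎
    where open ≡-Reasoning

  Σ-++ : ∀ (xs ys : List A) (f : A → ℤ) → Σ[ xs ++ ys ] f ≡ Σ[ xs ] f ℤ.+ Σ[ ys ] f
  Σ-++ [] ys f = sym (ℤP.+-identityˡ _)
  Σ-++ (x ∷ xs) ys f = trans (cong (λ t → f x ℤ.+ t) (Σ-++ xs ys f)) (sym (ℤP.+-assoc (f x) _ _))

  Σ-map : ∀ {B : Set} (xs : List A) (h : A → B) (f : B → ℤ) → Σ[ map h xs ] f ≡ Σ[ xs ] (f ∘ h)
  Σ-map [] h f = refl
  Σ-map (x ∷ xs) h f = cong (λ t → f (h x) ℤ.+ t) (Σ-map xs h f)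

  Σ-≡0 : ∀ (xs : List A) {f : A → ℤ} → (∀ {x} → x ∈ xs → f x ≡ 0ℤ) → Σ[ xs ] f ≡ 0ℤ
  Σ-≡0 xs f≡0 = trans (Σ-cong xs f≡0) (Σ-0 xs)

  Σ-Unique-singleton : ∀ (xs : List A) {c} (f : A → ℤ) → Unique xs → (∀ {x} → x ∈ xs → x ≡ c) →
                       c ∈ xs → Σ[ xs ] f ≡ f c
  Σ-Unique-singleton (x ∷ []) f _ xs≡c _ rewrite xs≡c (here refl) = ℤP.+-identityʳ (f _)
  Σ-Unique-singleton (x ∷ y ∷ xs) f (x∉ ∷ _) xs≡c _ =
    ⊥-elim (All.lookup x∉ (here refl) (trans (xs≡c (here refl)) (sym (xs≡c (there (here refl))))))

indicator : {P : Set} → Dec P → ℤ → ℤ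
indicator (yes _) a = a
indicator (no _) _ = 0ℤ

-- The hypothesis says that each key κ u occurs exactly once in keys.
Σ-fibres : {A K : Set} (_≟K_ : (k l : K) → Dec (k ≡ l)) (keys : List K) (κ : A → K) (f : A → ℤ)
  (T : List A) →
  (∀ {u} → u ∈ T → ∀ a → Σ[ keys ] (λ k → indicator (κ u ≟K k) a) ≡ a) →
  Σ[ T ] f ≡ Σ[ keys ] (λ k → Σ[ filter (λ u → κ u ≟K k) T ] f)
Σ-fibres _≟K_ keys κ f [] _ = sym (Σ-0 keys)
Σ-fibres _≟K_ keys κ f (u ∷ T) once = sym (begin
  Σ[ keys ] (λ k → Σ[ filter (λ v → κ v ≟K k) (u ∷ T) ] f)
    ≡⟨ Σ-cong keys (λ {k} _ → step k (κ u ≟K k)) ⟩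
  Σ[ keys ] (λ k → indicator (κ u ≟K k) (f u) ℤ.+ Σ[ filter (λ v → κ v ≟K k) T ] f)
    ≡⟨ Σ-+ keys (λ k → indicator (κ u ≟K k) (f u)) (λ k → Σ[ filter (λ v → κ v ≟K k) T ] f) ⟩
  Σ[ keys ] (λ k → indicator (κ u ≟K k) (f u)) ℤ.+
  Σ[ keys ] (λ k → Σ[ filter (λ v → κ v ≟K k) T ] f)
    ≡⟨ cong₂ ℤ._+_ (once (here refl) (f u)) (sym (Σ-fibres _≟K_ keys κ f T (once ∘ there))) ⟩
  f u ℤ.+ Σ[ T ] f ∎)
  where
  open ≡-Reasoning
  step : ∀ k (κu≟k : Dec (κ u ≡ k)) →
    Σ[ filter (λ v → κ v ≟K k) (u ∷ T) ] f ≡ indicator κu≟k (f u) ℤ.+ Σ[ filter (λ v → κ v ≟K k) T ] f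
  step k (yes κu≡k) = cong (Σ[_] f) (filter-accept (λ v → κ v ≟K k) {xs = T} κu≡k)
  step k (no κu≢k) =
    trans (cong (Σ[_] f) (filter-reject (λ v → κ v ≟K k) {xs = T} κu≢k)) (sym (ℤP.+-identityˡ _))

Σ-indicator-Unique : {A : Set} (_≟A_ : (x y : A) → Dec (x ≡ y)) (xs : List A) {x : A} (a : ℤ) →
  Unique xs → x ∈ xs → Σ[ xs ] (λ y → indicator (x ≟A y) a) ≡ a
Σ-indicator-Unique _≟A_ (y ∷ xs) {x} a (y∉xs ∷ xs!) x∈ with x ≟A y
... | yes refl = trans (cong (λ t → a ℤ.+ t) (trans (Σ-cong xs vanish) (Σ-0 xs))) (ℤP.+-identityʳ a)
  where vanish : ∀ {z} → z ∈ xs → indicator (x ≟A z) a ≡ 0ℤ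
        vanish {z} z∈ with x ≟A z
        ... | yes refl = ⊥-elim (All.lookup y∉xs z∈ refl)
        ... | no _ = refl
... | no x≢y with x∈
...   | here x≡y = ⊥-elim (x≢y x≡y)
...   | there x∈xs = trans (ℤP.+-identityˡ _) (Σ-indicator-Unique _≟A_ xs a xs! x∈xs)


signedSum : List (List ℕ) → ℤ
signedSum T = Σ[ T ] (sgn ∘ maxL)

altSum≡signedSum : ∀ T → altSum T ≡ signedSum T
altSum≡signedSum T = sym (begin
  Σ[ T ] (sgn ∘ maxL)
    ≡⟨ Σ-fibres _≟_ (upTo (suc N)) maxL (sgn ∘ maxL) T (λ u∈T a →
         Σ-indicator-Unique _≟_ (upTo (suc N)) a (UP.upTo⁺ (suc N))
           (∈-upTo⁺ (s≤s (≤-maxL (map maxL T) (∈-map⁺ maxL u∈T))))) ⟩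
  Σ[ upTo (suc N) ] (λ d → Σ[ filter (λ u → maxL u ≟ d) T ] (sgn ∘ maxL))
    ≡⟨ Σ-cong (upTo (suc N)) (λ {d} _ → Σ-const (filter (λ u → maxL u ≟ d) T)
         (λ u∈ → cong sgn (proj₂ (∈-filter⁻ (λ u → maxL u ≟ d) {xs = T} u∈)))) ⟩
  altSum T ∎)
  where
  open ≡-Reasoning
  N : ℕ
  N = maxL (map maxL T)

bools : ℕ → List (List Bool)
bools zero = [] ∷ []
bools (suc k) = map (true ∷_) (bools k) ++ map (false ∷_) (bools k)

Σ-bools-suc : ∀ k (f : List Bool → ℤ) →
              Σ[ bools (suc k) ] f ≡ Σ[ bools k ] (f ∘ (true ∷_)) ℤ.+ Σ[ bools k ] (f ∘ (false ∷_))
Σ-bools-suc k f =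
  trans (Σ-++ (map (true ∷_) (bools k)) _ f)
        (cong₂ ℤ._+_ (Σ-map (bools k) (true ∷_) f) (Σ-map (bools k) (false ∷_) f))

length-bools : ∀ k {S} → S ∈ bools k → length S ≡ k
length-bools zero (here refl) = refl
length-bools (suc k) S∈ with ∈-++⁻ (map (true ∷_) (bools k)) S∈
... | inj₁ p = let (S' , S'∈ , S≡) = ∈-map⁻ (true ∷_) p in
  trans (cong length S≡) (cong suc (length-bools k S'∈))
... | inj₂ p = let (S' , S'∈ , S≡) = ∈-map⁻ (false ∷_) p in
  trans (cong length S≡) (cong suc (length-bools k S'∈))

_≡?_ : (S S' : List Bool) → Dec (S ≡ S')
_≡?_ = ≡-dec Bool._≟_

indicator-⇔ : ∀ {P Q : Set} (a : ℤ) → P ⇔ Q → (p : Dec P) (q : Dec Q) → indicator p a ≡ indicator q a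
indicator-⇔ a _ (yes _) (yes _) = refl
indicator-⇔ a _ (no _) (no _) = refl
indicator-⇔ a P⇔Q (yes p) (no ¬q) = ⊥-elim (¬q (Equivalence.to P⇔Q p))
indicator-⇔ a P⇔Q (no ¬p) (yes q) = ⊥-elim (¬p (Equivalence.from P⇔Q q))

indicator-no : ∀ {P : Set} (a : ℤ) → ¬ P → (p : Dec P) → indicator p a ≡ 0ℤ
indicator-no a ¬p (yes p) = ⊥-elim (¬p p)
indicator-no a ¬p (no _) = refl

Σ-indicator-bools : ∀ S a → Σ[ bools (length S) ] (λ S' → indicator (S ≡? S') a) ≡ a
Σ-indicator-bools [] a = ℤP.+-identityʳ a
Σ-indicator-bools (b ∷ S) a = trans (Σ-bools-suc (length S) _) (split b)
  where
  B : List (List Bool)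
  B = bools (length S)
  same : ∀ b → Σ[ B ] (λ S' → indicator ((b ∷ S) ≡? (b ∷ S')) a) ≡ a
  same b = trans (Σ-cong B (λ {S'} _ → indicator-⇔ a (mk⇔ ∷-injectiveʳ (cong (b ∷_)))
                                                   ((b ∷ S) ≡? (b ∷ S')) (S ≡? S')))
                 (Σ-indicator-bools S a)
  other : ∀ b {b'} → b ≢ b' → Σ[ B ] (λ S' → indicator ((b ∷ S) ≡? (b' ∷ S')) a) ≡ 0ℤ
  other b b≢b' = Σ-≡0 B (λ {S'} _ → indicator-no a (b≢b' ∘ ∷-injectiveˡ) ((b ∷ S) ≡? (_ ∷ S')))
  split : ∀ b → Σ[ B ] (λ S' → indicator ((b ∷ S) ≡? (true ∷ S')) a) ℤ.+
                Σ[ B ] (λ S' → indicator ((b ∷ S) ≡? (false ∷ S')) a) ≡ a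
  split true = trans (cong₂ ℤ._+_ (same true) (other true {false} (λ ()))) (ℤP.+-identityʳ a)
  split false = trans (cong₂ ℤ._+_ (other false {true} (λ ())) (same false)) (ℤP.+-identityˡ a)

Σ-noHits : ∀ k c → Σ[ bools k ] (λ S → if or S then 0ℤ else c) ≡ c
Σ-noHits zero c = ℤP.+-identityʳ c
Σ-noHits (suc k) c = begin
  Σ[ bools (suc k) ] (λ S → if or S then 0ℤ else c)
    ≡⟨ Σ-bools-suc k _ ⟩
  Σ[ bools k ] (λ _ → 0ℤ) ℤ.+ Σ[ bools k ] (λ S → if or S then 0ℤ else c)
    ≡⟨ cong₂ ℤ._+_ (Σ-0 (bools k)) (Σ-noHits k c) ⟩
  0ℤ ℤ.+ c
    ≡⟨ ℤP.+-identityˡ c ⟩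
  c ∎
  where open ≡-Reasoning

sumMax : List (List ℕ) → ℕ
sumMax ws = foldr _+_ 0 (map maxL ws)

totalLength : List (List ℕ) → ℕ
totalLength ws = foldr _+_ 0 (map length ws)

sgn-+ : ∀ a b → sgn (a + b) ≡ sgn a ℤ.* sgn b
sgn-+ zero b = sym (ℤP.*-identityˡ (sgn b))
sgn-+ (suc a) b = trans (cong ℤ.-_ (sgn-+ a b)) (ℤP.neg-distribˡ-* (sgn a) (sgn b))

𝟙 : Bool → ℤ
𝟙 b = if b then 1ℤ else 0ℤ

𝟙-∧ : ∀ a b → 𝟙 (a Bool.∧ b) ≡ 𝟙 a ℤ.* 𝟙 b
𝟙-∧ true b = sym (ℤP.*-identityˡ (𝟙 b))
𝟙-∧ false b = refl

factorSign : Bool → List ℕ → ℤ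
factorSign false w = sgn (maxL w)
factorSign true [] = 0ℤ
factorSign true (c ∷ w) = sgn (maxL (deleteMax (c ∷ w)))

weight : List Bool → List (List ℕ) → ℤ
weight [] [] = 1ℤ
weight (b ∷ S) (w ∷ ws) = factorSign b w ℤ.* weight S ws
weight _ _ = 0ℤ

factorSign-cancel : ∀ w → Packed w → factorSign true w ℤ.+ factorSign false w ≡ 𝟙 (null w)
factorSign-cancel [] _ = refl
factorSign-cancel (c ∷ w) cw-packed = begin
  sgn m' ℤ.+ sgn (maxL (c ∷ w))   ≡⟨ cong (λ m → sgn m' ℤ.+ sgn m) (maxL-deleteMax c w cw-packed) ⟨
  sgn m' ℤ.+ ℤ.- sgn m'           ≡⟨ ℤP.+-inverseʳ (sgn m') ⟩
  0ℤ                              ∎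
  where
  open ≡-Reasoning
  m' : ℕ
  m' = maxL (deleteMax (c ∷ w))

Σ-weight : ∀ ws → All Packed ws → Σ[ bools (length ws) ] (λ S → weight S ws) ≡ 𝟙 (all null ws)
Σ-weight [] [] = refl
Σ-weight (w ∷ ws) (w-packed ∷ ws-packed) = begin
  Σ[ bools (suc k) ] (λ S → weight S (w ∷ ws))
    ≡⟨ Σ-bools-suc k _ ⟩
  Σ[ bools k ] (λ S → factorSign true w ℤ.* weight S ws) ℤ.+
  Σ[ bools k ] (λ S → factorSign false w ℤ.* weight S ws)
    ≡⟨ cong₂ ℤ._+_ (Σ-* (bools k) (factorSign true w) _) (Σ-* (bools k) (factorSign false w) _) ⟩
  factorSign true w ℤ.* Σ' ℤ.+ factorSign false w ℤ.* Σ'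
    ≡⟨ ℤP.*-distribʳ-+ Σ' (factorSign true w) (factorSign false w) ⟨
  (factorSign true w ℤ.+ factorSign false w) ℤ.* Σ'
    ≡⟨ cong₂ ℤ._*_ (factorSign-cancel w w-packed) (Σ-weight ws ws-packed) ⟩
  𝟙 (null w) ℤ.* 𝟙 (all null ws)
    ≡⟨ 𝟙-∧ (null w) (all null ws) ⟨
  𝟙 (all null (w ∷ ws)) ∎
  where
  open ≡-Reasoning
  k : ℕ
  k = length ws
  Σ' : ℤ
  Σ' = Σ[ bools k ] (λ S → weight S ws)

weight-admissible : ∀ S ws → admissible S ws ≡ true → weight S ws ≡ sgn (sumMax (deleteMaxAt S ws))
weight-admissible [] [] _ = refl
weight-admissible (true ∷ S) ((c ∷ w) ∷ ws) adm =
  trans (cong (sgn (maxL (deleteMax (c ∷ w))) ℤ.*_) (weight-admissible S ws adm))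
    (sym (sgn-+ (maxL (deleteMax (c ∷ w))) (sumMax (deleteMaxAt S ws))))
weight-admissible (false ∷ S) (w ∷ ws) adm =
  trans (cong (sgn (maxL w) ℤ.*_) (weight-admissible S ws adm)) (sym (sgn-+ (maxL w) (sumMax (deleteMaxAt S ws))))

weight-inadmissible : ∀ S ws → admissible S ws ≡ false → weight S ws ≡ 0ℤ
weight-inadmissible [] (w ∷ ws) _ = refl
weight-inadmissible (b ∷ S) [] _ = refl
weight-inadmissible (true ∷ S) ([] ∷ ws) _ = refl
weight-inadmissible (true ∷ S) ((c ∷ w) ∷ ws) adm =
  trans (cong (sgn (maxL (deleteMax (c ∷ w))) ℤ.*_) (weight-inadmissible S ws adm))
    (ℤP.*-zeroʳ (sgn (maxL (deleteMax (c ∷ w)))))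
weight-inadmissible (false ∷ S) (w ∷ ws) adm =
  trans (cong (sgn (maxL w) ℤ.*_) (weight-inadmissible S ws adm)) (ℤP.*-zeroʳ (sgn (maxL w)))

weight-noHits : ∀ S ws → or S ≡ false → length S ≡ length ws → weight S ws ≡ sgn (sumMax ws)
weight-noHits [] [] _ _ = refl
weight-noHits (false ∷ S) (w ∷ ws) noHits len =
  trans (cong (sgn (maxL w) ℤ.*_) (weight-noHits S ws noHits (suc-injective len))) (sym (sgn-+ (maxL w) (sumMax ws)))

-- Chosen so that the hit-free fibre, whose signed sum is 𝟙 (all null ws), equals - weight S ws + noHitsTerm ws S.
noHitsTerm : List (List ℕ) → List Bool → ℤ
noHitsTerm ws S = if or S then 0ℤ else 𝟙 (all null ws) ℤ.+ sgn (sumMax ws)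

All-Packed-deleteMaxAt : ∀ S ws → All Packed ws → All Packed (deleteMaxAt S ws)
All-Packed-deleteMaxAt (true ∷ S) (w ∷ ws) (w-packed ∷ ws-packed) =
  Packed-deleteMax w w-packed ∷ All-Packed-deleteMaxAt S ws ws-packed
All-Packed-deleteMaxAt (false ∷ S) (w ∷ ws) (w-packed ∷ ws-packed) =
  w-packed ∷ All-Packed-deleteMaxAt S ws ws-packed
All-Packed-deleteMaxAt [] _ _ = []
All-Packed-deleteMaxAt (_ ∷ _) [] _ = []

totalLength-deleteMaxAt-≤ : ∀ S ws → admissible S ws ≡ true → totalLength (deleteMaxAt S ws) ≤ totalLength ws
totalLength-deleteMaxAt-≤ [] [] _ = ≤-refl
totalLength-deleteMaxAt-≤ (true ∷ S) ((c ∷ w) ∷ ws) adm =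
  +-mono-≤ (length-filter (λ y → ¬? (y ≟ maxL (c ∷ w))) (c ∷ w)) (totalLength-deleteMaxAt-≤ S ws adm)
totalLength-deleteMaxAt-≤ (false ∷ S) (w ∷ ws) adm =
  +-monoʳ-≤ (length w) (totalLength-deleteMaxAt-≤ S ws adm)

totalLength-deleteMaxAt-< : ∀ S ws → admissible S ws ≡ true → or S ≡ true →
                            totalLength (deleteMaxAt S ws) < totalLength ws
totalLength-deleteMaxAt-< (true ∷ S) ((c ∷ w) ∷ ws) adm _ =
  +-mono-<-≤ (length-delete-< (c ∷ w) (maxL-∈ c w)) (totalLength-deleteMaxAt-≤ S ws adm)
totalLength-deleteMaxAt-< (false ∷ S) (w ∷ ws) adm hit =
  +-monoʳ-< (length w) (totalLength-deleteMaxAt-< S ws adm hit)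

Unique-map-injectiveOn : ∀ {A B : Set} (f : A → B) xs → Unique xs →
                         (∀ {x y} → x ∈ xs → y ∈ xs → f x ≡ f y → x ≡ y) → Unique (map f xs)
Unique-map-injectiveOn f [] _ _ = []
Unique-map-injectiveOn f (x ∷ xs) (x∉xs ∷ xs!) inj =
  fx∉ ∷ Unique-map-injectiveOn f xs xs! (λ p q → inj (there p) (there q))
  where
  fx∉ : All (f x ≢_) (map f xs)
  fx∉ = All.tabulate λ z∈ fx≡z →
    let (y , y∈ , z≡fy) = ∈-map⁻ f z∈ in All.lookup x∉xs y∈ (inj (here refl) (there y∈) (trans fx≡z z≡fy))

Cut-[] : ∀ ws → Cut ws [] → all null ws ≡ true
Cut-[] [] _ = refl
Cut-[] ([] ∷ ws) (_ , cut) = Cut-[] ws cut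

all-null⇒Cut-[] : ∀ ws → all null ws ≡ true → Cut ws []
all-null⇒Cut-[] [] _ = refl
all-null⇒Cut-[] ([] ∷ ws) allNull = refl , all-null⇒Cut-[] ws allNull

noHits-≡ : ∀ S S' → or S ≡ false → or S' ≡ false → length S ≡ length S' → S ≡ S'
noHits-≡ [] [] _ _ _ = refl
noHits-≡ (false ∷ S) (false ∷ S') noHits noHits' len =
  cong (false ∷_) (noHits-≡ S S' noHits noHits' (suc-injective len))

maxPattern-[] : ∀ ws → Cut ws [] → or (maxPattern ws []) ≡ false
maxPattern-[] ws cut with or (maxPattern ws []) in hit
... | false = refl
... | true with maxL-∈-maxPattern ws [] cut hit
...   | ()

module Fibres (ws : List (List ℕ)) (ws-packed : All Packed ws) (T : List (List ℕ)) (T! : Unique T)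
              (T-spec : ∀ u → u ∈ T ⇔ InProduct ws u) where

  fibre : List Bool → List (List ℕ)
  fibre S = filter (λ u → maxPattern ws u ≡? S) T

  ∈-fibre⁻ : ∀ {S u} → u ∈ fibre S → InProduct ws u × maxPattern ws u ≡ S
  ∈-fibre⁻ {S} u∈ = let (u∈T , pattern≡) = ∈-filter⁻ (λ u → maxPattern ws u ≡? S) {xs = T} u∈ in
    Equivalence.to (T-spec _) u∈T , pattern≡

  ∈-fibre⁺ : ∀ {S u} → InProduct ws u → maxPattern ws u ≡ S → u ∈ fibre S
  ∈-fibre⁺ {S} u∈prod = ∈-filter⁺ (λ u → maxPattern ws u ≡? S) (Equivalence.from (T-spec _) u∈prod)

  signedSum-fibres : signedSum T ≡ Σ[ bools (length ws) ] (signedSum ∘ fibre)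
  signedSum-fibres = Σ-fibres _≡?_ (bools (length ws)) (maxPattern ws) (sgn ∘ maxL) T λ {u} _ a →
    subst (λ k → Σ[ bools k ] (λ S → indicator (maxPattern ws u ≡? S) a) ≡ a) (length-maxPattern ws u)
      (Σ-indicator-bools (maxPattern ws u) a)

  Unique-fibre : ∀ S → Unique (fibre S)
  Unique-fibre S = UP.filter⁺ (λ u → maxPattern ws u ≡? S) T!

  module _ {S} (hit : or S ≡ true) where

    private
      deleteMax-injectiveOn : ∀ {u u'} → u ∈ fibre S → u' ∈ fibre S → deleteMax u ≡ deleteMax u' → u ≡ u'
      deleteMax-injectiveOn {u} {u'} u∈ u'∈ deleteMax≡ = begin
        u                                  ≡⟨ recover u∈ ⟨
        insertTop S ws (deleteMax u)       ≡⟨ cong (insertTop S ws) deleteMax≡ ⟩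
        insertTop S ws (deleteMax u')      ≡⟨ recover u'∈ ⟩
        u'                                 ∎
        where
        open ≡-Reasoning
        recover : ∀ {u} → u ∈ fibre S → insertTop S ws (deleteMax u) ≡ u
        recover {u} u∈ with ∈-fibre⁻ u∈
        ... | u∈prod , refl = insertTop-deleteMax ws u u∈prod hit

    Unique-deleteMax-fibre : Unique (map deleteMax (fibre S))
    Unique-deleteMax-fibre = Unique-map-injectiveOn deleteMax (fibre S) (Unique-fibre S) deleteMax-injectiveOn

    deleteMax-fibre-spec : admissible S ws ≡ true →
                           ∀ v → v ∈ map deleteMax (fibre S) ⇔ InProduct (deleteMaxAt S ws) v
    deleteMax-fibre-spec adm v = mk⇔ to from
      where
      to : v ∈ map deleteMax (fibre S) → InProduct (deleteMaxAt S ws) v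
      to v∈ with ∈-map⁻ deleteMax v∈
      ... | u , u∈ , refl with ∈-fibre⁻ u∈
      ...   | u∈prod , refl = InProduct-deleteMax ws u u∈prod
      from : InProduct (deleteMaxAt S ws) v → v ∈ map deleteMax (fibre S)
      from v∈prod =
        let (u∈prod , pattern≡ , deleteMax≡) = InProduct-insertTop S ws v v∈prod adm hit ws-packed in
        subst (_∈ map deleteMax (fibre S)) deleteMax≡ (∈-map⁺ deleteMax (∈-fibre⁺ u∈prod pattern≡))

    signedSum-fibre-hit : signedSum (fibre S) ≡ ℤ.- signedSum (map deleteMax (fibre S))
    signedSum-fibre-hit = begin
      Σ[ fibre S ] (sgn ∘ maxL)                  ≡⟨ Σ-cong (fibre S) lowers ⟩
      Σ[ fibre S ] (ℤ.-_ ∘ sgn ∘ maxL ∘ deleteMax) ≡⟨ Σ-neg (fibre S) (sgn ∘ maxL ∘ deleteMax) ⟩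
      ℤ.- Σ[ fibre S ] (sgn ∘ maxL ∘ deleteMax)  ≡⟨ cong ℤ.-_ (Σ-map (fibre S) deleteMax (sgn ∘ maxL)) ⟨
      ℤ.- signedSum (map deleteMax (fibre S))    ∎
      where
      open ≡-Reasoning
      lowers : ∀ {u} → u ∈ fibre S → sgn (maxL u) ≡ ℤ.- sgn (maxL (deleteMax u))
      lowers {u} u∈ with ∈-fibre⁻ u∈
      ... | (u-packed , cut) , refl =
        cong sgn (sym (deleteMax-lowers u u-packed (maxL-∈-maxPattern ws u cut hit)))

  signedSum-fibre-inadmissible : ∀ S → admissible S ws ≡ false → signedSum (fibre S) ≡ 0ℤ
  signedSum-fibre-inadmissible S adm = Σ-≡0 (fibre S) absurd
    where
    absurd : ∀ {u} → u ∈ fibre S → sgn (maxL u) ≡ 0ℤ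
    absurd u∈ with ∈-fibre⁻ u∈
    ... | (_ , cut) , refl with () ← trans (sym (admissible-hits (Cut⇒Packs ws _ cut))) adm

  fibre-noHits-empty : ∀ {S u} → or S ≡ false → u ∈ fibre S → u ≡ []
  fibre-noHits-empty {u = []} _ _ = refl
  fibre-noHits-empty {u = c ∷ u} noHits u∈ with ∈-fibre⁻ u∈
  ... | (_ , cut) , refl with () ← trans (sym (maxPattern-nonempty ws c u cut)) noHits

  signedSum-fibre-noHits : ∀ S → or S ≡ false → length S ≡ length ws →
                           signedSum (fibre S) ≡ 𝟙 (all null ws)
  signedSum-fibre-noHits S noHits len with all null ws in allNull
  ... | true = Σ-Unique-singleton (fibre S) (sgn ∘ maxL) (Unique-fibre S) (fibre-noHits-empty noHits)
                 (∈-fibre⁺ (Packed-[] , cut) (noHits-≡ (maxPattern ws []) S (maxPattern-[] ws cut) noHits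
                   (trans (length-maxPattern ws []) (sym len))))
    where
    cut : Cut ws []
    cut = all-null⇒Cut-[] ws allNull
  ... | false = Σ-≡0 (fibre S) absurd
    where
    absurd : ∀ {u} → u ∈ fibre S → sgn (maxL u) ≡ 0ℤ
    absurd u∈ with fibre-noHits-empty noHits u∈ | ∈-fibre⁻ u∈
    ... | refl | (_ , cut) , _ with () ← trans (sym (Cut-[] ws cut)) allNull

  signedSum-fibre : (∀ S → or S ≡ true → admissible S ws ≡ true →
                      signedSum (map deleteMax (fibre S)) ≡ sgn (sumMax (deleteMaxAt S ws))) →
                    ∀ S → length S ≡ length ws → signedSum (fibre S) ≡ ℤ.- weight S ws ℤ.+ noHitsTerm ws S
  signedSum-fibre IH S len with or S in hit | admissible S ws in adm
  ... | true | true = begin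
    signedSum (fibre S)                      ≡⟨ signedSum-fibre-hit hit ⟩
    ℤ.- signedSum (map deleteMax (fibre S))  ≡⟨ cong ℤ.-_ (IH S hit adm) ⟩
    ℤ.- sgn (sumMax (deleteMaxAt S ws))      ≡⟨ cong ℤ.-_ (weight-admissible S ws adm) ⟨
    ℤ.- weight S ws                          ≡⟨ ℤP.+-identityʳ _ ⟨
    ℤ.- weight S ws ℤ.+ 0ℤ                   ∎
    where open ≡-Reasoning
  ... | true | false =
    trans (signedSum-fibre-inadmissible S adm) (cong (λ x → ℤ.- x ℤ.+ 0ℤ) (sym (weight-inadmissible S ws adm)))
  ... | false | _ = begin
    signedSum (fibre S)          ≡⟨ signedSum-fibre-noHits S hit len ⟩
    𝟙 (all null ws)              ≡⟨ ℤ-lemma (𝟙 (all null ws)) (sgn (sumMax ws)) ⟩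
    ℤ.- sgn (sumMax ws) ℤ.+ c    ≡⟨ cong (λ x → ℤ.- x ℤ.+ c) (weight-noHits S ws hit len) ⟨
    ℤ.- weight S ws ℤ.+ c        ∎
    where
    open ≡-Reasoning
    c : ℤ
    c = 𝟙 (all null ws) ℤ.+ sgn (sumMax ws)
    ℤ-lemma : ∀ (e s : ℤ) → e ≡ ℤ.- s ℤ.+ (e ℤ.+ s)
    ℤ-lemma = solve-∀

signedSum-product : ∀ ws → Acc (_<_ on totalLength) ws → All Packed ws →
  ∀ T → Unique T → (∀ u → u ∈ T ⇔ InProduct ws u) → signedSum T ≡ sgn (sumMax ws)
signedSum-product ws (acc smaller) ws-packed T T! T-spec = begin
  signedSum T
    ≡⟨ signedSum-fibres ⟩
  Σ[ B ] (signedSum ∘ fibre)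
    ≡⟨ Σ-cong B (λ S∈ → signedSum-fibre IH _ (length-bools _ S∈)) ⟩
  Σ[ B ] (λ S → ℤ.- weight S ws ℤ.+ noHitsTerm ws S)
    ≡⟨ Σ-+ B (λ S → ℤ.- weight S ws) (noHitsTerm ws) ⟩
  Σ[ B ] (λ S → ℤ.- weight S ws) ℤ.+ Σ[ B ] (noHitsTerm ws)
    ≡⟨ cong₂ ℤ._+_ (Σ-neg B (λ S → weight S ws)) (Σ-noHits (length ws) c) ⟩
  ℤ.- Σ[ B ] (λ S → weight S ws) ℤ.+ c
    ≡⟨ cong (λ x → ℤ.- x ℤ.+ c) (Σ-weight ws ws-packed) ⟩
  ℤ.- 𝟙 (all null ws) ℤ.+ (𝟙 (all null ws) ℤ.+ sgn (sumMax ws))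
    ≡⟨ ℤ-lemma (𝟙 (all null ws)) (sgn (sumMax ws)) ⟩
  sgn (sumMax ws) ∎
  where
  open ≡-Reasoning
  open Fibres ws ws-packed T T! T-spec
  B : List (List Bool)
  B = bools (length ws)
  c : ℤ
  c = 𝟙 (all null ws) ℤ.+ sgn (sumMax ws)
  ℤ-lemma : ∀ (e s : ℤ) → ℤ.- e ℤ.+ (e ℤ.+ s) ≡ s
  ℤ-lemma = solve-∀
  IH : ∀ S → or S ≡ true → admissible S ws ≡ true →
    signedSum (map deleteMax (fibre S)) ≡ sgn (sumMax (deleteMaxAt S ws))
  IH S hit adm = signedSum-product (deleteMaxAt S ws) (smaller (totalLength-deleteMaxAt-< S ws adm hit))
    (All-Packed-deleteMaxAt S ws ws-packed) (map deleteMax (fibre S))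
    (Unique-deleteMax-fibre hit) (deleteMax-fibre-spec hit adm)

lemma6p7 : (w : List ℕ) (ws : List (List ℕ)) → All Packed (w ∷ ws) →
    (T : List (List ℕ)) → Unique T → (∀ u → (u ∈ T) ⇔ InProduct (w ∷ ws) u) →
    altSum T ≡ sgn (foldr _+_ 0 (map maxL (w ∷ ws)))
lemma6p7 w ws ws-packed T T! T-spec =
  begin
    altSum T                   ≡⟨ altSum≡signedSum T ⟩
    signedSum T                ≡⟨ signedSum-product (w ∷ ws) (On.wellFounded totalLength <-wellFounded (w ∷ ws))
                                                    ws-packed T T! T-spec ⟩
    sgn (sumMax (w ∷ ws))      ∎
  where open ≡-Reasoning
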